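{- For every integer $q>3$, $f(3,q)<3e^{1/2}\,2^q\,q!$.
   Context: A word over an alphabet is a finite string of letters; a subword of $w$ is a string of consecutive letters of $w$. A word $w$ contains a pattern $P$ if there is a map assigning to each letter of $P$ a nonempty word (different letters may receive equal words) such that the word obtained from $P$ by replacing each letter by its assigned word is a subword of $w$. $Z_3=x_1x_2x_1x_3x_1x_2x_1$. $f(3,q)$ denotes the smallest integer such that every word of length $f(3,q)$ over an alphabet of size $q$ contains $Z_3$. -}

module Defs where

open import Data.Nat as ℕ using (ℕ; zero; suc; _!; _^_)
open import Data.Nat.Properties using (_!≢0; m*n≢0; m^n≢0)
open import Data.Integer using (+_)
open import Data.Rational as ℚ using (ℚ; _/_; _+_; _*_; _<_)
open import Data.Fin as Fin using (Fin)
open import Data.List using (List; []; _∷_; _++_; length; concatMap)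
open import Data.Product using (Σ; ∃; ∃-syntax; _×_)
open import Relation.Binary.PropositionalEquality using (_≡_; _≢_)

-- A pattern over pattern-letters Fin k is a list of such letters.
-- A substitution assigns to each pattern letter a word over A
-- (different letters may get equal words).
substitute : ∀ {A : Set} {k : ℕ} → (Fin k → List A) → List (Fin k) → List A
substitute φ P = concatMap φ P

IsSubword : ∀ {A : Set} → List A → List A → Set
IsSubword {A} u w = ∃[ x ] ∃[ y ] (w ≡ x ++ u ++ y)

Contains : ∀ {A : Set} {k : ℕ} → List A → List (Fin k) → Set
Contains {A} {k} w P =
  Σ (Fin k → List A) λ φ → ((i : Fin k) → φ i ≢ []) × IsSubword (substitute φ P) w

Z₃ : List (Fin 3)
Z₃ = x₁ ∷ x₂ ∷ x₁ ∷ x₃ ∷ x₁ ∷ x₂ ∷ x₁ ∷ []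
  where
    x₁ x₂ x₃ : Fin 3
    x₁ = Fin.zero
    x₂ = Fin.suc Fin.zero
    x₃ = Fin.suc (Fin.suc Fin.zero)

AllWordsContainZ₃ : ℕ → ℕ → Set
AllWordsContainZ₃ q n = (w : List (Fin q)) → length w ≡ n → Contains w Z₃

IsF3 : ℕ → ℕ → Set
IsF3 q n = AllWordsContainZ₃ q n × (∀ m → AllWordsContainZ₃ q m → n ℕ.≤ m)

ePartial : ℕ → ℚ
ePartial zero = + 1 / 1
ePartial (suc k) = ePartial k + ((+ 1 / (suc k) !) {{(suc k) !≢0}})

-- r < e  (e = sup of the increasing partial sums Σ_{i≤k} 1/i!)
_<e : ℚ → Set
r <e = ∃[ k ] (r < ePartial k)

-- n < 3 e^{1/2} 2^q q!   ⇔  n² < 9 e 4^q (q!)²  ⇔  n²/(9·4^q·(q!)²) < e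
LtBound : ℕ → ℕ → Set
LtBound q n =
  ((+ (n ℕ.* n) / (9 ℕ.* (4 ^ q) ℕ.* (q ! ℕ.* q !)))
     {{m*n≢0 (9 ℕ.* 4 ^ q) (q ! ℕ.* q !) {{m*n≢0 9 (4 ^ q) {{_}} {{m^n≢0 4 q}}}} {{m*n≢0 (q !) (q !) {{q !≢0}} {{q !≢0}}}}}}) <e

module Submission where

-- Let w be a Z₃-free word of length n over q letters. Call positions a and t with t ≥ a + 2 and
-- w[a] = w[t] a distant pair, and let M be least such that w[M, n) contains no distant pair; there
-- equal letters are adjacent, so n ≤ 2q + M. For i < M let t be the least position closing a distant
-- pair opened at or after i, and r the last such opening: then w[i, t) has only adjacent repeats and
-- w[r, t] = cXc. In a Z₃-free word two occurrences of cXc (c ∉ X) can neither overlap nor leave a gap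
-- between them, so cXc occurs at most twice. Hence i is determined by c, X, r − i and one bit (or,
-- when w[r, t] = ccc, the position of r among the at most four occurrences of ccc); X consists of
-- single or doubled distinct letters other than c, and r − i is at most twice the number of letters
-- X leaves unused. Counting these codes bounds M by about 4.5 · 2^q q!, so that
-- f(3,q) ≤ 1 + 2q + M < 4.9 · 2^q q! < 3 e^{1/2} 2^q q!.

open import Defs
open import Data.Nat
  using (ℕ; zero; suc; pred; _+_; _*_; _∸_; _^_; _!; _≤_; _<_; _≤?_; _<?_; z≤n; s≤s; _≤′_; ≤′-refl; ≤′-step;
         NonZero; >-nonZero)
open import Data.Nat.Properties
open import Data.Nat.Induction using (<-wellFounded)
open import Data.Nat.ListAction using (sum)
open import Data.Nat.ListAction.Properties using (sum-++)
open import Data.Nat.Tactic.RingSolver using (solve-∀)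
open import Data.Integer as ℤ using (+<+)
import Data.Integer.Properties as ℤ
open import Data.Rational as ℚ using (_/_)
open import Data.Rational.Properties using (toℚᵘ-cancel-<; toℚᵘ-fromℚᵘ)
import Data.Rational.Unnormalised as ℚᵘ
open import Data.Rational.Unnormalised.Properties using (<-respˡ-≃; ≃-sym)
open import Data.Bool using (Bool; true; false)
open import Data.Empty using (⊥)
open import Data.Fin as Fin using (Fin; toℕ)
open import Data.Fin.Properties using (all?; injective⇒≤; toℕ<n; toℕ-injective)
open import Data.List using (List; []; _∷_; _++_; [_]; length; take; drop; filter; map; concatMap; upTo; allFin; lookup)
open import Data.List.Properties
  using (++-monoid; ++-assoc; ++-conicalʳ; length-++; length-map; length-upTo; length-tabulate; length-take;
         filter-notAll; take++drop≡id; drop-drop; map-++; map-cong)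
open import Data.List.Membership.Propositional using (_∈_; _∉_)
open import Data.List.Membership.Propositional.Properties
  using (∈-allFin; ∈-upTo⁺; ∈-map⁺; ∈-++⁺ˡ; ∈-++⁺ʳ; ∈-concatMap⁺; ∈-filter⁺)
open import Data.List.Relation.Unary.Any using (here; there)
import Data.List.Relation.Unary.Any as Any
open import Data.List.Relation.Unary.Any.Properties using (lookup-index)
open import Data.Maybe using (Maybe; just; nothing)
import Data.Maybe.Properties as Maybe
open import Data.Sum using (inj₁; inj₂)
open import Data.Product using (∃; ∃-syntax; _×_; _,_; proj₁; proj₂)
open import Function using (_∘_)
open import Induction.WellFounded using (Acc; acc)
open import Relation.Nullary using (¬_; Dec; yes; no; ¬?; contradiction)
open import Relation.Nullary.Decidable using (_×-dec_; map′; decidable-stable; isYes)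
open import Relation.Unary using (Decidable)
open import Relation.Binary.Definitions using (DecidableEquality; tri<; tri≈; tri>)
open import Relation.Binary.PropositionalEquality hiding ([_])

infixl 9 _‼_
_‼_ : ∀ {A : Set} → List A → ℕ → Maybe A
[]       ‼ _     = nothing
(x ∷ xs) ‼ zero  = just x
(x ∷ xs) ‼ suc i = xs ‼ i

module _ {A : Set} where

  ‼-++ʳ : ∀ (xs ys : List A) k → (xs ++ ys) ‼ (length xs + k) ≡ ys ‼ k
  ‼-++ʳ []       ys k = refl
  ‼-++ʳ (x ∷ xs) ys k = ‼-++ʳ xs ys k

  ‼-++ˡ : ∀ (xs ys : List A) {k} → k < length xs → (xs ++ ys) ‼ k ≡ xs ‼ k
  ‼-++ˡ (x ∷ xs) ys {zero}  _         = refl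
  ‼-++ˡ (x ∷ xs) ys {suc k} (s≤s k<n) = ‼-++ˡ xs ys k<n

  <⇒‼-just : ∀ (xs : List A) {i} → i < length xs → ∃[ x ] xs ‼ i ≡ just x
  <⇒‼-just (x ∷ xs) {zero}  _         = x , refl
  <⇒‼-just (x ∷ xs) {suc i} (s≤s i<n) = <⇒‼-just xs i<n

  ‼-just⇒< : ∀ (xs : List A) i {x} → xs ‼ i ≡ just x → i < length xs
  ‼-just⇒< (y ∷ xs) zero    _  = s≤s z≤n
  ‼-just⇒< (y ∷ xs) (suc i) eq = s≤s (‼-just⇒< xs i eq)

  ‼⇒∈ : ∀ (xs : List A) k {x} → xs ‼ k ≡ just x → x ∈ xs
  ‼⇒∈ (y ∷ xs) zero    refl = here refl
  ‼⇒∈ (y ∷ xs) (suc k) eq   = there (‼⇒∈ xs k eq)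

  ∈⇒‼ : ∀ {x} (xs : List A) → x ∈ xs → ∃[ k ] xs ‼ k ≡ just x
  ∈⇒‼ (y ∷ xs) (here refl) = zero , refl
  ∈⇒‼ (y ∷ xs) (there x∈)  with k , eq ← ∈⇒‼ xs x∈ = suc k , eq

  ∈-concatMap⁺′ : ∀ {B : Set} (f : A → List B) {x xs y} → x ∈ xs → y ∈ f x → y ∈ concatMap f xs
  ∈-concatMap⁺′ f x∈xs y∈fx = ∈-concatMap⁺ f (Any.map (λ { refl → y∈fx }) x∈xs)

  ‼-drop : ∀ (xs : List A) i k → drop i xs ‼ k ≡ xs ‼ (i + k)
  ‼-drop []       zero    k = refl
  ‼-drop []       (suc i) k = refl
  ‼-drop (x ∷ xs) zero    k = refl
  ‼-drop (x ∷ xs) (suc i) k = ‼-drop xs i k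

  ‼-take-< : ∀ (xs : List A) {m k} → k < m → take m xs ‼ k ≡ xs ‼ k
  ‼-take-< []       {suc m}         _         = refl
  ‼-take-< (x ∷ xs) {suc m} {zero}  _         = refl
  ‼-take-< (x ∷ xs) {suc m} {suc k} (s≤s k<m) = ‼-take-< xs k<m

  ‼-take-≥ : ∀ (xs : List A) {m k} → m ≤ k → take m xs ‼ k ≡ nothing
  ‼-take-≥ []       {zero}  _         = refl
  ‼-take-≥ []       {suc m} _         = refl
  ‼-take-≥ (x ∷ xs) {zero}  _         = refl
  ‼-take-≥ (x ∷ xs) {suc m} (s≤s m≤k) = ‼-take-≥ xs m≤k

  ‼-extensionality : ∀ (xs ys : List A) → (∀ k → xs ‼ k ≡ ys ‼ k) → xs ≡ ys
  ‼-extensionality []       []       _  = refl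
  ‼-extensionality []       (y ∷ ys) eq with () ← eq 0
  ‼-extensionality (x ∷ xs) []       eq with () ← eq 0
  ‼-extensionality (x ∷ xs) (y ∷ ys) eq with refl ← eq 0 =
    cong (x ∷_) (‼-extensionality xs ys (λ k → eq (suc k)))

  drop-‼ : ∀ (xs : List A) i {x} → xs ‼ i ≡ just x → drop i xs ≡ x ∷ drop (suc i) xs
  drop-‼ (y ∷ xs) zero    refl = refl
  drop-‼ (y ∷ xs) (suc i) eq   = drop-‼ xs i eq

  take-suc-‼ : ∀ (xs : List A) m {x} → xs ‼ m ≡ just x → take (suc m) xs ≡ take m xs ++ [ x ]
  take-suc-‼ (y ∷ xs) zero    refl = refl
  take-suc-‼ (y ∷ xs) (suc m) eq   = cong (y ∷_) (take-suc-‼ xs m eq)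

  length-take-drop : ∀ (xs : List A) i m → i + m ≤ length xs → length (take m (drop i xs)) ≡ m
  length-take-drop xs       zero    zero    _         = refl
  length-take-drop (x ∷ xs) zero    (suc m) (s≤s le) = cong suc (length-take-drop xs zero m le)
  length-take-drop (x ∷ xs) (suc i) m       (s≤s le) = length-take-drop xs i m le

n≤1+pred[n] : ∀ n → n ≤ suc (pred n)
n≤1+pred[n] zero    = z≤n
n≤1+pred[n] (suc n) = ≤-refl

Least : (ℕ → Set) → ℕ → Set
Least P k = P k × (∀ {j} → j < k → ¬ P j)

GreatestBelow : ℕ → (ℕ → Set) → ℕ → Set
GreatestBelow t P k = k < t × P k × (∀ {j} → k < j → j < t → ¬ P j)

module _ {P : ℕ → Set} (P? : Decidable P) where

  least : ∀ {n} → P n → ∃ (Least P)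
  least = search (<-wellFounded _)
    where
    search : ∀ {n} → Acc _<_ n → P n → ∃ (Least P)
    search {n} (acc smaller) pn with anyUpTo? P? n
    ... | yes (j , j<n , pj) = search (smaller j<n) pj
    ... | no  none           = n , pn , λ j<n pj → none (_ , j<n , pj)

  greatestBelow : ∀ {j t} → j < t → P j → ∃ (GreatestBelow t P)
  greatestBelow {j} {suc t} j<1+t pj with P? t | j ≟ t
  ... | yes pt | _        = t , ≤-refl , pt , λ t<k k<1+t _ → <⇒≱ t<k (≤-pred k<1+t)
  ... | no ¬pt | yes refl = contradiction pj ¬pt
  ... | no ¬pt | no  j≢t  with greatestBelow (≤∧≢⇒< (≤-pred j<1+t) j≢t) pj
  ...   | k , k<t , pk , above = k , m≤n⇒m≤1+n k<t , pk , beyond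
    where
    beyond : ∀ {l} → k < l → l < suc t → ¬ P l
    beyond {l} k<l l<1+t with l ≟ t
    ... | yes refl = ¬pt
    ... | no  l≢t  = above k<l (≤∧≢⇒< (≤-pred l<1+t) l≢t)

module _ {P : ℕ → Set} where

  Least-≤ : ∀ {k n} → Least P k → P n → k ≤ n
  Least-≤ (_ , below) pn = ≮⇒≥ (λ n<k → below n<k pn)

  Least-unique : ∀ {k l} → Least P k → Least P l → k ≡ l
  Least-unique lk ll = ≤-antisym (Least-≤ lk (proj₁ ll)) (Least-≤ ll (proj₁ lk))

-- runWords f B lists the words made of at most f runs a or aa of pairwise distinct letters a of B,
-- each paired with the letters of B it leaves unused.
module RunWords {A : Set} (_≟_ : DecidableEquality A) where

  remove : A → List A → List A
  remove a = filter (λ y → ¬? (y ≟ a))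

  length-remove-∈ : ∀ {a xs} → a ∈ xs → length (remove a xs) < length xs
  length-remove-∈ {a} {xs} a∈xs =
    filter-notAll (λ y → ¬? (y ≟ a)) xs (Any.map (λ a≡y y≢a → y≢a (sym a≡y)) a∈xs)

  length-remove-∈-≤ : ∀ {a xs f} → a ∈ xs → length xs ≤ suc f → length (remove a xs) ≤ f
  length-remove-∈-≤ a∈xs lxs = ≤-pred (≤-trans (length-remove-∈ a∈xs) lxs)

  ∈-remove : ∀ {a y xs} → y ∈ xs → y ≢ a → y ∈ remove a xs
  ∈-remove = ∈-filter⁺ (λ y → ¬? (y ≟ _))

  extend : List A → List A × List A → List A × List A
  extend u (X , C) = u ++ X , C

  runWords runWords⁺ : ℕ → List A → List (List A × List A)
  runWords f B = ([] , B) ∷ runWords⁺ f B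
  runWords⁺ zero    B = []
  runWords⁺ (suc f) B = concatMap (λ a → map (extend [ a ]) (runWords f (remove a B))
                                       ++ map (extend (a ∷ a ∷ [])) (runWords f (remove a B))) B

  single∈runWords⁺ : ∀ {f a B X C} → a ∈ B → (X , C) ∈ runWords f (remove a B) →
                     (a ∷ X , C) ∈ runWords⁺ (suc f) B
  single∈runWords⁺ {a = a} a∈B mem = ∈-concatMap⁺′ _ a∈B (∈-++⁺ˡ (∈-map⁺ (extend [ a ]) mem))

  double∈runWords⁺ : ∀ {f a B X C} → a ∈ B → (X , C) ∈ runWords f (remove a B) →
                     (a ∷ a ∷ X , C) ∈ runWords⁺ (suc f) B
  double∈runWords⁺ {f} {a} {B} a∈B mem =
    ∈-concatMap⁺′ _ a∈B (∈-++⁺ʳ (map (extend [ a ]) (runWords f (remove a B))) (∈-map⁺ (extend (a ∷ a ∷ [])) mem))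

module Segments {A : Set} (_≟_ : DecidableEquality A) (w : List A) where
  open RunWords _≟_

  -- Each letter of w[i, j) fills a single run, of length at most 2.
  RunDistinct : ℕ → ℕ → Set
  RunDistinct i j = ∀ {a b} → i ≤ a → a < b → b < j → w ‼ a ≡ w ‼ b → b ≡ suc a

  RunDistinct-mono : ∀ {i j i′ j′} → RunDistinct i j → i ≤ i′ → j′ ≤ j → RunDistinct i′ j′
  RunDistinct-mono rd i≤i′ j′≤j i′≤a a<b b<j′ = rd (≤-trans i≤i′ i′≤a) a<b (<-≤-trans b<j′ j′≤j)

  noDistantRepeat⇒RunDistinct : ∀ {i j} → (∀ {a b} → i ≤ a → 2 + a ≤ b → b < j → w ‼ a ≢ w ‼ b) →
                                RunDistinct i j
  noDistantRepeat⇒RunDistinct noRepeat i≤a a<b b<j wa≡wb with m≤n⇒m<n∨m≡n a<b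
  ... | inj₁ 1+a<b = contradiction wa≡wb (noRepeat i≤a 1+a<b b<j)
  ... | inj₂ 1+a≡b = sym 1+a≡b

  UsesOnly : List A → ℕ → ℕ → Set
  UsesOnly B i j = ∀ {a} → i ≤ a → a < j → ∃[ y ] w ‼ a ≡ just y × y ∈ B

  Avoids : A → ℕ → ℕ → Set
  Avoids y i j = ∀ {a} → i ≤ a → a < j → w ‼ a ≢ just y

  UsesOnly-remove : ∀ {B a i i′ j} → w ‼ i ≡ just a → UsesOnly B i j → i ≤ i′ →
                    (∀ {b} → i′ ≤ b → b < j → w ‼ b ≢ w ‼ i) → UsesOnly (remove a B) i′ j
  UsesOnly-remove wi≡a only i≤i′ noA i′≤b b<j with only (≤-trans i≤i′ i′≤b) b<j
  ... | y , wb≡y , y∈B = y , wb≡y , ∈-remove y∈B (λ { refl → noA i′≤b b<j (trans wb≡y (sym wi≡a)) })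

  data FirstRun (i j : ℕ) : Set where
    single : (∀ {a} → suc i ≤ a → a < j → w ‼ a ≢ w ‼ i) → FirstRun i j
    double : suc i < j → w ‼ suc i ≡ w ‼ i → (∀ {a} → 2 + i ≤ a → a < j → w ‼ a ≢ w ‼ i) → FirstRun i j

  firstRun : ∀ {i j} → RunDistinct i j → FirstRun i j
  firstRun {i} {j} rd with suc i <? j | Maybe.≡-dec _≟_ (w ‼ suc i) (w ‼ i)
  ... | yes 1+i<j | yes same = double 1+i<j same λ 2+i≤a a<j wa≡wi →
          <⇒≢ 2+i≤a (sym (rd ≤-refl (<-trans (n<1+n i) 2+i≤a) a<j (sym wa≡wi)))
  ... | yes 1+i<j | no differ = single λ i<a a<j wa≡wi →
          differ (subst (λ b → w ‼ b ≡ w ‼ i) (rd ≤-refl i<a a<j (sym wa≡wi)) wa≡wi)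
  ... | no 1+i≮j  | _ = single λ i<a a<j wa≡wi →
          1+i≮j (subst (_< j) (rd ≤-refl i<a a<j (sym wa≡wi)) a<j)

  firstRun-end : ∀ {i j} → FirstRun i j →
                 ∃[ i′ ] i < i′ × i′ ≤ 2 + i × (∀ {b} → i′ ≤ b → b < j → w ‼ b ≢ w ‼ i)
  firstRun-end {i} (single noA)     = suc i , ≤-refl , n≤1+n _ , noA
  firstRun-end {i} (double _ _ noA) = 2 + i , n≤1+n _ , ≤-refl , noA

  runDistinct-length : ∀ {B i j} → RunDistinct i j → UsesOnly B i j → j ≤ 2 * length B + i
  runDistinct-length = bound (<-wellFounded _)
    where
    bound : ∀ {B i j} → Acc _<_ (length B) → RunDistinct i j → UsesOnly B i j → j ≤ 2 * length B + i
    bound {B} {i} {j} (acc smaller) rd only with j ≤? i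
    ... | yes j≤i = ≤-trans j≤i (m≤n+m i _)
    ... | no  j≰i with only ≤-refl (≰⇒> j≰i) | firstRun-end (firstRun rd)
    ...   | a , wi≡a , a∈B | i′ , i<i′ , i′≤2+i , noA = begin
      j                                  ≤⟨ bound (smaller shorter) rd′ only′ ⟩
      2 * length (remove a B) + i′       ≤⟨ +-monoʳ-≤ _ i′≤2+i ⟩
      2 * length (remove a B) + (2 + i)  ≡⟨ rearrange (length (remove a B)) i ⟩
      2 * suc (length (remove a B)) + i  ≤⟨ +-monoˡ-≤ i (*-monoʳ-≤ 2 shorter) ⟩
      2 * length B + i                   ∎
      where
      open ≤-Reasoning
      shorter = length-remove-∈ a∈B
      rd′     = RunDistinct-mono rd (<⇒≤ i<i′) ≤-refl
      only′   = UsesOnly-remove wi≡a only (<⇒≤ i<i′) noA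
      rearrange : ∀ l i → 2 * l + (2 + i) ≡ 2 * suc l + i
      rearrange = solve-∀

  segment : ℕ → ℕ → List A
  segment s e = take (e ∸ s) (drop s w)

  segment-[] : ∀ {s e} → e ≤ s → segment s e ≡ []
  segment-[] {s} {e} e≤s rewrite m≤n⇒m∸n≡0 e≤s = refl

  segment-∷ : ∀ {s e a} → s < e → w ‼ s ≡ just a → segment s e ≡ a ∷ segment (suc s) e
  segment-∷ {s} {e} s<e ws≡a
    rewrite drop-‼ w s ws≡a | sym (pred[m∸n]≡m∸[1+n] e s) with e ∸ s | m>n⇒m∸n≢0 s<e
  ... | zero  | ≢0 = contradiction refl ≢0
  ... | suc _ | _  = refl

  segment-‼ : ∀ {s e k} → k < e ∸ s → segment s e ‼ k ≡ w ‼ (s + k)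
  segment-‼ {s} {e} {k} k<e∸s = trans (‼-take-< (drop s w) k<e∸s) (‼-drop w s k)

  length-segment : ∀ {s e} → s ≤ e → e ≤ length w → length (segment s e) ≡ e ∸ s
  length-segment {s} {e} s≤e e≤n =
    length-take-drop w s (e ∸ s) (subst (_≤ length w) (sym (m+[n∸m]≡n s≤e)) e≤n)

  Realises : List (List A × List A) → List A → ℕ → ℕ → Set
  Realises R B s e = ∃[ C ] (segment s e , C) ∈ R × (∀ {y} → y ∈ B → Avoids y s e → y ∈ C)

  Realises-prepend : ∀ {R R′ B a s s′ e u} → w ‼ s ≡ just a → s < e → s < s′ →
                     (∀ {X C} → (X , C) ∈ R′ → (u ++ X , C) ∈ R) → segment s e ≡ u ++ segment s′ e →
                     Realises R′ (remove a B) s′ e → Realises R B s e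
  Realises-prepend ws≡a s<e s<s′ embed split (C , mem , keeps) =
    C , subst (λ X → (X , C) ∈ _) (sym split) (embed mem) ,
    λ y∈B avoids → keeps (∈-remove y∈B (λ { refl → avoids ≤-refl s<e ws≡a }))
                         (λ s′≤b → avoids (≤-trans (<⇒≤ s<s′) s′≤b))

  segment∈runWords  : ∀ f {B s e} → length B ≤ f → RunDistinct s e → UsesOnly B s e →
                      Realises (runWords f B) B s e
  segment∈runWords⁺ : ∀ f {B s e} → length B ≤ f → RunDistinct s e → UsesOnly B s e → s < e →
                      Realises (runWords⁺ f B) B s e

  segment∈runWords f {B} {s} {e} lB rd only with s <? e
  ... | no s≮e =
    B , subst (λ X → (X , B) ∈ runWords f B) (sym (segment-[] (≮⇒≥ s≮e))) (here refl) , λ y∈B _ → y∈B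
  ... | yes s<e with segment∈runWords⁺ f lB rd only s<e
  ...   | C , mem , keeps = C , there mem , keeps

  segment∈runWords⁺ zero {B} lB _ only s<e with only ≤-refl s<e
  ... | _ , _ , a∈B = contradiction lB (<⇒≱ (≤-<-trans z≤n (length-remove-∈ a∈B)))
  segment∈runWords⁺ (suc f) {B} {s} {e} lB rd only s<e with only ≤-refl s<e | firstRun rd
  ... | a , ws≡a , a∈B | single noA =
    Realises-prepend ws≡a s<e (n<1+n s) (single∈runWords⁺ {f} a∈B) (segment-∷ s<e ws≡a)
      (segment∈runWords f (length-remove-∈-≤ a∈B lB) (RunDistinct-mono rd (n≤1+n s) ≤-refl)
         (UsesOnly-remove ws≡a only (n≤1+n s) noA))
  ... | a , ws≡a , a∈B | double 1+s<e same noA =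
    Realises-prepend ws≡a s<e s<2+s (double∈runWords⁺ {f} a∈B)
      (trans (segment-∷ s<e ws≡a) (cong (a ∷_) (segment-∷ 1+s<e (trans same ws≡a))))
      (segment∈runWords f (length-remove-∈-≤ a∈B lB) (RunDistinct-mono rd (<⇒≤ s<2+s) ≤-refl)
         (UsesOnly-remove ws≡a only (<⇒≤ s<2+s) noA))
    where s<2+s = ≤-trans (n<1+n s) (n≤1+n _)

  Avoids⇒∉segment : ∀ {c s e} → Avoids c s e → c ∉ segment s e
  Avoids⇒∉segment {c} {s} {e} avoids c∈ with ∈⇒‼ (segment s e) c∈
  ... | k , eq = avoids (m≤m+n s k) s+k<e (trans (sym (segment-‼ k<e∸s)) eq)
    where
    k<e∸s : k < e ∸ s
    k<e∸s = <-≤-trans (‼-just⇒< (segment s e) k eq)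
                      (≤-trans (≤-reflexive (length-take (e ∸ s) (drop s w))) (m⊓n≤m _ _))
    s≤e : s ≤ e
    s≤e = <⇒≤ (m∸n≢0⇒n<m (λ e∸s≡0 → n≮0 (subst (k <_) e∸s≡0 k<e∸s)))
    s+k<e : s + k < e
    s+k<e = subst (s + k <_) (m+[n∸m]≡n s≤e) (+-monoʳ-< s k<e∸s)

-- Z₃ as two occurrences of a word cXc

module _ {A : Set} where

  ≢[]⇒0<length : ∀ {X : List A} → X ≢ [] → 0 < length X
  ≢[]⇒0<length {[]}    X≢[] = contradiction refl X≢[]
  ≢[]⇒0<length {_ ∷ _} _    = s≤s z≤n

  bracket : A → List A → List A
  bracket c X = c ∷ X ++ [ c ]

  length-bracket : ∀ c X → length (bracket c X) ≡ 2 + length X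
  length-bracket c X = cong suc (trans (length-++ X) (+-comm (length X) 1))

  bracket-last : ∀ c X → bracket c X ‼ suc (length X) ≡ just c
  bracket-last c X = trans (cong (λ k → (X ++ [ c ]) ‼ k) (sym (+-identityʳ (length X)))) (‼-++ʳ X [ c ] 0)

  record Z₃Factorisation (w : List A) : Set where
    field
      c         : A
      x X Y z   : List A
      X≢[]      : X ≢ []
      Y≢[]      : Y ≢ []
      factorise : w ≡ x ++ bracket c X ++ Y ++ bracket c X ++ z

  private
    open import Algebra.Solver.Monoid (++-monoid A) using (solve; _⊕_; _⊜_; id)

    -- With a = C ++ a′, the image a b a g a b a of Z₃ regroups as C(a′b)C · a′g · C(a′b)C · a′.
    regroup : ∀ (C a′ b g y : List A) →
              ((C ++ a′) ++ (b ++ ((C ++ a′) ++ (g ++ ((C ++ a′) ++ (b ++ ((C ++ a′) ++ []))))))) ++ y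
              ≡ (C ++ (a′ ++ b) ++ C) ++ (a′ ++ g) ++ (C ++ (a′ ++ b) ++ C) ++ (a′ ++ y)
    regroup = solve 5 (λ C a b g y → ((C ⊕ a) ⊕ b ⊕ (C ⊕ a) ⊕ g ⊕ (C ⊕ a) ⊕ b ⊕ (C ⊕ a) ⊕ id) ⊕ y
                                   ⊜ (C ⊕ (a ⊕ b) ⊕ C) ⊕ (a ⊕ g) ⊕ (C ⊕ (a ⊕ b) ⊕ C) ⊕ (a ⊕ y)) refl

    ungroup : ∀ (C X Y z : List A) →
              (C ++ X ++ C) ++ Y ++ (C ++ X ++ C) ++ z
              ≡ (C ++ (X ++ (C ++ (Y ++ (C ++ (X ++ (C ++ [])))))))  ++ z
    ungroup = solve 4 (λ C X Y z → (C ⊕ X ⊕ C) ⊕ Y ⊕ (C ⊕ X ⊕ C) ⊕ z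
                                 ⊜ (C ⊕ (X ⊕ (C ⊕ (Y ⊕ (C ⊕ (X ⊕ (C ⊕ id))))))) ⊕ z) refl

  Contains⇒Z₃Factorisation : ∀ {w} → Contains w Z₃ → Z₃Factorisation w
  Contains⇒Z₃Factorisation {w} (φ , nonEmpty , x , y , w≡) =
    factorisation (φ Fin.zero) (nonEmpty Fin.zero) (nonEmpty (Fin.suc Fin.zero)) (nonEmpty (Fin.suc (Fin.suc Fin.zero))) w≡
    where
    b = φ (Fin.suc Fin.zero)
    g = φ (Fin.suc (Fin.suc Fin.zero))
    factorisation : ∀ a → a ≢ [] → b ≢ [] → g ≢ [] →
                    w ≡ x ++ (a ++ (b ++ (a ++ (g ++ (a ++ (b ++ (a ++ []))))))) ++ y → Z₃Factorisation w
    factorisation []       a≢[] _    _    _  = contradiction refl a≢[]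
    factorisation (c ∷ a′) _    b≢[] g≢[] w≡ = record
      { c = c ; x = x ; X = a′ ++ b ; Y = a′ ++ g ; z = a′ ++ y
      ; X≢[] = λ eq → b≢[] (++-conicalʳ a′ b eq)
      ; Y≢[] = λ eq → g≢[] (++-conicalʳ a′ g eq)
      ; factorise = trans w≡ (cong (x ++_) (regroup [ c ] a′ b g y))
      }

  Z₃Factorisation⇒Contains : ∀ {w} → Z₃Factorisation w → Contains w Z₃
  Z₃Factorisation⇒Contains record { c = c ; x = x ; X = X ; Y = Y ; z = z ; X≢[] = X≢[] ; Y≢[] = Y≢[] ; factorise = w≡ } =
    φ , nonEmpty , x , z , trans w≡ (cong (x ++_) (ungroup [ c ] X Y z))
    where
    φ : Fin 3 → List A
    φ Fin.zero                   = [ c ]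
    φ (Fin.suc Fin.zero)         = X
    φ (Fin.suc (Fin.suc Fin.zero)) = Y
    nonEmpty : ∀ i → φ i ≢ []
    nonEmpty Fin.zero                     ()
    nonEmpty (Fin.suc Fin.zero)           = X≢[]
    nonEmpty (Fin.suc (Fin.suc Fin.zero)) = Y≢[]

module _ {A : Set} (w : List A) where

  OccursAt : ℕ → List A → Set
  OccursAt p u = ∀ {k} → k < length u → w ‼ (p + k) ≡ u ‼ k

  -- Index form of a Z₃-factorisation: the factor cXc = w[p₁, p₁ + L] recurs at p₂ after a nonempty gap.
  Z₃At : ℕ → ℕ → ℕ → Set
  Z₃At p₁ p₂ L = 2 ≤ L × p₁ + suc L < p₂ × p₂ + suc L ≤ length w × w ‼ p₁ ≡ w ‼ (p₁ + L)
               × (∀ {k} → k < suc L → w ‼ (p₁ + k) ≡ w ‼ (p₂ + k))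

  occurrences⇒Z₃At : ∀ {p p′ c X} → OccursAt p (bracket c X) → OccursAt p′ (bracket c X) → X ≢ [] →
                     p + (2 + length X) < p′ → Z₃At p p′ (suc (length X))
  occurrences⇒Z₃At {p} {p′} {c} {X} occ occ′ X≢[] gap =
    s≤s (≢[]⇒0<length X≢[]) , gap ,
    subst (_≤ length w) (sym (+-suc p′ _)) (‼-just⇒< w _ (trans (occ′ last<) (bracket-last c X))) ,
    trans (cong (w ‼_) (sym (+-identityʳ p))) (trans (occ (s≤s z≤n)) (sym (trans (occ last<) (bracket-last c X)))) ,
    λ k<L → trans (occ (inBracket k<L)) (sym (occ′ (inBracket k<L)))
    where
    inBracket : ∀ {k} → k < 2 + length X → k < length (bracket c X)
    inBracket {k} = subst (k <_) (sym (length-bracket c X))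
    last< : suc (length X) < length (bracket c X)
    last< = inBracket ≤-refl

  ++-OccursAt : ∀ x u r → w ≡ x ++ u ++ r → OccursAt (length x) u
  ++-OccursAt x u r refl {k} k<u = trans (‼-++ʳ x (u ++ r) k) (‼-++ˡ u r k<u)

  Z₃Factorisation⇒Z₃At : Z₃Factorisation w → ∃[ p₁ ] ∃[ p₂ ] ∃[ L ] Z₃At p₁ p₂ L
  Z₃Factorisation⇒Z₃At record { c = c ; x = x ; X = X ; Y = Y ; z = z ; X≢[] = X≢[] ; Y≢[] = Y≢[] ; factorise = w≡ } =
    _ , _ , _ , occurrences⇒Z₃At (++-OccursAt x u (Y ++ u ++ z) w≡) (++-OccursAt (x ++ u ++ Y) u z w≡′) X≢[] gap
    where
    u = bracket c X
    w≡′ : w ≡ (x ++ u ++ Y) ++ u ++ z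
    w≡′ = trans w≡ (trans (cong (x ++_) (sym (++-assoc u Y (u ++ z)))) (sym (++-assoc x (u ++ Y) (u ++ z))))
    gap : length x + (2 + length X) < length (x ++ u ++ Y)
    gap = begin-strict
      length x + (2 + length X)                  <⟨ +-monoʳ-< (length x) (m<m+n _ (≢[]⇒0<length Y≢[])) ⟩
      length x + (2 + length X + length Y)       ≡⟨ cong (λ n → length x + (n + length Y)) (length-bracket c X) ⟨
      length x + (length u + length Y)           ≡⟨ cong (length x +_) (length-++ u) ⟨
      length x + length (u ++ Y)                 ≡⟨ length-++ x ⟨
      length (x ++ u ++ Y)                       ∎
      where open ≤-Reasoning

  drop-split : ∀ i m → drop i w ≡ take m (drop i w) ++ drop (i + m) w
  drop-split i m = trans (sym (take++drop≡id m (drop i w))) (cong (take m (drop i w) ++_) (drop-drop i m w))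

  take-suc-drop-≢[] : ∀ {i} m → i < length w → take (suc m) (drop i w) ≢ []
  take-suc-drop-≢[] {i} m i<n with <⇒‼-just w i<n
  ... | a , wi≡a rewrite drop-‼ w i wi≡a = λ ()

  Z₃At⇒Z₃Factorisation : ∀ {p₁ p₂ L} → Z₃At p₁ p₂ L → Z₃Factorisation w
  Z₃At⇒Z₃Factorisation {p₁} {p₂} {L@(suc (suc L₀))} (s≤s (s≤s _) , gap , bound , ends , agree) with <⇒‼-just w p₁<n
    where
    p₂<n : p₂ < length w
    p₂<n = <-≤-trans (m<m+n p₂ (s≤s z≤n)) bound
    p₁<n : p₁ < length w
    p₁<n = ≤-<-trans (m≤m+n p₁ (suc L)) (<-trans gap p₂<n)
  ... | c , wp₁≡c = record
    { c = c ; x = take p₁ w ; X = X ; Y = Y ; z = drop (p₂ + suc L) w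
    ; X≢[] = take-suc-drop-≢[] L₀ (≤-<-trans (subst (_≤ p₁ + suc L) (+-comm p₁ 1) (+-monoʳ-≤ p₁ (s≤s z≤n)))
                                            (<-trans gap p₂<n))
    ; Y≢[] = take-suc-drop-≢[] g (<-trans (≤-<-trans ≤-refl gap) p₂<n)
    ; factorise = begin
        w                                                  ≡⟨ take++drop≡id p₁ w ⟨
        take p₁ w ++ drop p₁ w                             ≡⟨ cong (take p₁ w ++_) (drop-split p₁ (suc L)) ⟩
        take p₁ w ++ u ++ drop (p₁ + suc L) w              ≡⟨ cong (λ r → take p₁ w ++ u ++ r) (drop-split (p₁ + suc L) (suc g)) ⟩
        take p₁ w ++ u ++ Y ++ drop (p₁ + suc L + suc g) w ≡⟨ cong (λ i → take p₁ w ++ u ++ Y ++ drop i w) p₂≡ ⟨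
        take p₁ w ++ u ++ Y ++ drop p₂ w                   ≡⟨ cong (λ r → take p₁ w ++ u ++ Y ++ r) (drop-split p₂ (suc L)) ⟩
        take p₁ w ++ u ++ Y ++ v ++ drop (p₂ + suc L) w    ≡⟨ cong (λ v → take p₁ w ++ u ++ Y ++ v ++ _) v≡u ⟩
        take p₁ w ++ u ++ Y ++ u ++ drop (p₂ + suc L) w    ≡⟨ cong (λ u → take p₁ w ++ u ++ Y ++ u ++ _) u≡ ⟩
        _                                                  ∎
    }
    where
    open ≡-Reasoning
    p₂<n : p₂ < length w
    p₂<n = <-≤-trans (m<m+n p₂ (s≤s z≤n)) bound
    u = take (suc L) (drop p₁ w)
    v = take (suc L) (drop p₂ w)
    X = take (suc L₀) (drop (suc p₁) w)
    g = p₂ ∸ suc (p₁ + suc L)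
    Y = take (suc g) (drop (p₁ + suc L) w)
    p₂≡ : p₂ ≡ p₁ + suc L + suc g
    p₂≡ = sym (trans (+-suc (p₁ + suc L) g) (m+[n∸m]≡n gap))
    lastLetter : drop (suc p₁) w ‼ suc L₀ ≡ just c
    lastLetter = trans (‼-drop w (suc p₁) (suc L₀)) (trans (cong (w ‼_) (sym (+-suc p₁ (suc L₀)))) (trans (sym ends) wp₁≡c))
    u≡ : u ≡ bracket c X
    u≡ rewrite drop-‼ w p₁ wp₁≡c = cong (c ∷_) (take-suc-‼ (drop (suc p₁) w) (suc L₀) lastLetter)
    v≡u : v ≡ u
    v≡u = ‼-extensionality v u pointwise
      where
      pointwise : ∀ k → v ‼ k ≡ u ‼ k
      pointwise k with k <? suc L
      ... | yes k<L = begin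
        v ‼ k             ≡⟨ ‼-take-< (drop p₂ w) k<L ⟩
        drop p₂ w ‼ k     ≡⟨ ‼-drop w p₂ k ⟩
        w ‼ (p₂ + k)      ≡⟨ agree k<L ⟨
        w ‼ (p₁ + k)      ≡⟨ ‼-drop w p₁ k ⟨
        drop p₁ w ‼ k     ≡⟨ ‼-take-< (drop p₁ w) k<L ⟨
        u ‼ k             ∎
      ... | no  k≮L = trans (‼-take-≥ (drop p₂ w) (≮⇒≥ k≮L)) (sym (‼-take-≥ (drop p₁ w) (≮⇒≥ k≮L)))

  Z₃At-bounded : ∀ {p₁ p₂ L} → Z₃At p₁ p₂ L → p₁ < length w × p₂ < length w × L < length w
  Z₃At-bounded {p₁} {p₂} {L} (_ , gap , bound , _) =
    <-trans (≤-<-trans (m≤m+n p₁ (suc L)) gap) p₂<n , p₂<n ,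
    <-≤-trans (s≤s (m≤n+m L p₂)) (subst (_≤ length w) (+-suc p₂ L) bound)
    where
    p₂<n = <-≤-trans (m<m+n p₂ (s≤s z≤n)) bound

module _ {A : Set} (_≟_ : DecidableEquality A) (w : List A) where

  Z₃At? : ∀ p₁ p₂ L → Dec (Z₃At w p₁ p₂ L)
  Z₃At? p₁ p₂ L = 2 ≤? L ×-dec p₁ + suc L <? p₂ ×-dec p₂ + suc L ≤? length w
           ×-dec Maybe.≡-dec _≟_ (w ‼ p₁) (w ‼ (p₁ + L))
           ×-dec allUpTo? (λ k → Maybe.≡-dec _≟_ (w ‼ (p₁ + k)) (w ‼ (p₂ + k))) (suc L)

  OccursAt? : ∀ p u → Dec (OccursAt w p u)
  OccursAt? p u = allUpTo? (λ k → Maybe.≡-dec _≟_ (w ‼ (p + k)) (u ‼ k)) (length u)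

  Contains-Z₃? : Dec (Contains w Z₃)
  Contains-Z₃? = map′ (λ (_ , _ , _ , _ , _ , _ , z) → Z₃Factorisation⇒Contains (Z₃At⇒Z₃Factorisation w z))
                      (λ contains → bounded (Z₃Factorisation⇒Z₃At w (Contains⇒Z₃Factorisation contains)))
                      (anyUpTo? (λ p₁ → anyUpTo? (λ p₂ → anyUpTo? (Z₃At? p₁ p₂) n) n) n)
    where
    n = length w
    bounded : (∃[ p₁ ] ∃[ p₂ ] ∃[ L ] Z₃At w p₁ p₂ L) →
              ∃[ p₁ ] p₁ < n × ∃[ p₂ ] p₂ < n × ∃[ L ] L < n × Z₃At w p₁ p₂ L
    bounded (p₁ , p₂ , L , z) with Z₃At-bounded w z
    ... | p₁<n , p₂<n , L<n = p₁ , p₁<n , p₂ , p₂<n , L , L<n , z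

module _ {A : Set} (w : List A) where

  occurrences-apart : ∀ {p p′ c X} → OccursAt w p (bracket c X) → OccursAt w p′ (bracket c X) → c ∉ X →
                      p < p′ → p + suc (length X) ≤ p′
  occurrences-apart {p} {p′} {c} {X} occ occ′ c∉X p<p′ with p + suc (length X) ≤? p′
  ... | yes apart = apart
  ... | no overlapping = contradiction (‼⇒∈ X k (begin
      X ‼ k                 ≡⟨ ‼-++ˡ X [ c ] k<X ⟨
      bracket c X ‼ suc k   ≡⟨ occ (subst (suc k <_) (sym (length-bracket c X)) (s≤s (m≤n⇒m≤1+n k<X))) ⟨
      w ‼ (p + suc k)       ≡⟨ cong (w ‼_) p+1+k≡p′ ⟩
      w ‼ p′                ≡⟨ cong (w ‼_) (+-identityʳ p′) ⟨
      w ‼ (p′ + 0)          ≡⟨ occ′ (s≤s z≤n) ⟩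
      just c                ∎)) c∉X
    where
    open ≡-Reasoning
    k = p′ ∸ suc p
    p+1+k≡p′ : p + suc k ≡ p′
    p+1+k≡p′ = trans (+-suc p k) (m+[n∸m]≡n p<p′)
    k<X : k < length X
    k<X = ≤-pred (+-cancelˡ-< p (suc k) (suc (length X)) (subst (_< p + suc (length X)) (sym p+1+k≡p′) (≰⇒> overlapping)))

  segment-bracket-OccursAt : ∀ (_≟_ : DecidableEquality A) {r t c} → w ‼ r ≡ just c → w ‼ t ≡ just c → r < t →
                             OccursAt w r (bracket c (Segments.segment _≟_ w (suc r) t))
  segment-bracket-OccursAt _≟_ {r} {t} {c} wr≡c wt≡c r<t = occurs
    where
    X = Segments.segment _≟_ w (suc r) t
    |X|≡ : length X ≡ t ∸ suc r
    |X|≡ = Segments.length-segment _≟_ w r<t (<⇒≤ (‼-just⇒< w t wt≡c))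
    occurs : OccursAt w r (bracket c X)
    occurs {zero} _ = trans (cong (w ‼_) (+-identityʳ r)) wr≡c
    occurs {suc k} (s≤s k<) with k <? length X
    ... | yes k<X = begin
        w ‼ (r + suc k)        ≡⟨ cong (w ‼_) (+-suc r k) ⟩
        w ‼ (suc r + k)        ≡⟨ Segments.segment-‼ _≟_ w {e = t} (subst (k <_) |X|≡ k<X) ⟨
        X ‼ k                  ≡⟨ ‼-++ˡ X [ c ] k<X ⟨
        bracket c X ‼ suc k    ∎
      where open ≡-Reasoning
    ... | no  k≮X = begin
        w ‼ (r + suc k)           ≡⟨ cong (λ k → w ‼ (r + suc k)) k≡|X| ⟩
        w ‼ (r + suc (length X))  ≡⟨ cong (w ‼_) (trans (+-suc r _) (trans (cong (suc r +_) |X|≡) (m+[n∸m]≡n r<t))) ⟩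
        w ‼ t                     ≡⟨ wt≡c ⟩
        just c                    ≡⟨ bracket-last c X ⟨
        bracket c X ‼ suc (length X) ≡⟨ cong (λ k → bracket c X ‼ suc k) k≡|X| ⟨
        bracket c X ‼ suc k       ∎
      where
      open ≡-Reasoning
      k≡|X| : k ≡ length X
      k≡|X| = ≤-antisym (≤-pred (subst (k <_) (trans (length-++ X) (+-comm _ 1)) k<)) (≮⇒≥ k≮X)

module _ {A : Set} {w : List A} (free : ¬ Contains w Z₃) where

  occurrences-close : ∀ {p p′ c X} → OccursAt w p (bracket c X) → OccursAt w p′ (bracket c X) → X ≢ [] →
                      p′ ≤ p + (2 + length X)
  occurrences-close occ occ′ X≢[] =
    ≮⇒≥ (λ gap → free (Z₃Factorisation⇒Contains (Z₃At⇒Z₃Factorisation w (occurrences⇒Z₃At w occ occ′ X≢[] gap))))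

  no-three-occurrences : ∀ {p₀ p₁ p₂ c X} → OccursAt w p₀ (bracket c X) → OccursAt w p₁ (bracket c X) →
                         OccursAt w p₂ (bracket c X) → c ∉ X → X ≢ [] → p₀ < p₁ → p₁ < p₂ → ⊥
  no-three-occurrences {p₀} {p₁} {p₂} {c} {X} occ₀ occ₁ occ₂ c∉X X≢[] p₀<p₁ p₁<p₂ =
    <⇒≱ (begin-strict
      p₀ + (2 + length X)              <⟨ m<m+n _ (≢[]⇒0<length X≢[]) ⟩
      p₀ + (2 + length X) + length X   ≡⟨ regroup p₀ (length X) ⟩
      p₀ + suc (length X) + suc (length X) ≤⟨ +-monoˡ-≤ _ (occurrences-apart w occ₀ occ₁ c∉X p₀<p₁) ⟩
      p₁ + suc (length X)              ≤⟨ occurrences-apart w occ₁ occ₂ c∉X p₁<p₂ ⟩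
      p₂                               ∎)
      (occurrences-close occ₀ occ₂ X≢[])
    where
    open ≤-Reasoning
    regroup : ∀ p l → p + (2 + l) + l ≡ p + suc l + suc l
    regroup = solve-∀

-- Z₃-free words

length-allFin : ∀ q → length (allFin q) ≡ q
length-allFin q = length-tabulate {n = q} (λ i → i)

length-remove-allFin : ∀ {q} (c : Fin q) → length (RunWords.remove Fin._≟_ c (allFin q)) < q
length-remove-allFin {q} c =
  subst (length (RunWords.remove Fin._≟_ c (allFin q)) <_) (length-allFin q) (RunWords.length-remove-∈ Fin._≟_ (∈-allFin c))

-- A closing (r, t, c) of i is encoded by c, the offset r ∸ i and, if w[r, t] = ccc, the distance of r from
-- the first occurrence of ccc; otherwise by c, X = w(r, t), the offset and whether cXc occurs before r.
data Code (q : ℕ) : Set where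
  tripled : Fin q → ℕ → ℕ → Code q
  plain   : Fin q → List (Fin q) → ℕ → Bool → Code q

plainCodes : ∀ {q} → Fin q → List (Fin q) × List (Fin q) → List (Code q)
plainCodes c (X , B) = map (λ o → plain c X o false) (upTo (2 * length B + 2)) ++ map (λ o → plain c X o true) (upTo 2)

tripledCodes : ∀ q → Fin q → List (Code q)
tripledCodes q c = concatMap (λ o → map (tripled c o) (upTo 4)) (upTo (2 * q))

codesFor : ∀ q → Fin q → List (Code q)
codesFor q c = concatMap (plainCodes c) (RunWords.runWords⁺ Fin._≟_ q (RunWords.remove Fin._≟_ c (allFin q))) ++ tripledCodes q c

codes : ∀ q → List (Code q)
codes q = concatMap (codesFor q) (allFin q)

module Z₃Free {q : ℕ} (w : List (Fin q)) (free : ¬ Contains w Z₃) where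
  open RunWords (Fin._≟_ {q})
  open Segments (Fin._≟_ {q}) w

  n = length w

  DistantPair : ℕ → ℕ → ℕ → Set
  DistantPair i a t = i ≤ a × 2 + a ≤ t × w ‼ a ≡ w ‼ t

  Closes : ℕ → ℕ → Set
  Closes i t = t < n × ∃[ a ] a < t × DistantPair i a t

  HasDistantPair : ℕ → Set
  HasDistantPair i = ∃[ t ] t < n × Closes i t

  DistantPair? : ∀ i t a → Dec (DistantPair i a t)
  DistantPair? i t a = i ≤? a ×-dec 2 + a ≤? t ×-dec Maybe.≡-dec Fin._≟_ (w ‼ a) (w ‼ t)

  Closes? : ∀ i t → Dec (Closes i t)
  Closes? i t = t <? n ×-dec anyUpTo? (DistantPair? i t) t

  HasDistantPair? : ∀ i → Dec (HasDistantPair i)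
  HasDistantPair? i = anyUpTo? (Closes? i) n

  pairFreeStart : ∃ (Least (¬_ ∘ HasDistantPair))
  pairFreeStart = least (¬? ∘ HasDistantPair?) λ (_ , t<n , _ , a , a<t , n≤a , _) → <⇒≱ (<-trans a<t t<n) n≤a

  M = proj₁ pairFreeStart

  <M⇒HasDistantPair : ∀ {i} → i < M → HasDistantPair i
  <M⇒HasDistantPair i<M = decidable-stable (HasDistantPair? _) (proj₂ (proj₂ pairFreeStart) i<M)

  RunDistinct-M : RunDistinct M n
  RunDistinct-M = noDistantRepeat⇒RunDistinct λ {a} {b} M≤a 2+a≤b b<n wa≡wb →
    proj₁ (proj₂ pairFreeStart) (b , b<n , b<n , a , <-trans (n<1+n a) 2+a≤b , M≤a , 2+a≤b , wa≡wb)

  length≤2q+M : n ≤ 2 * q + M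
  length≤2q+M = subst (λ k → n ≤ 2 * k + M) (length-allFin q) (runDistinct-length RunDistinct-M letters)
    where
    letters : UsesOnly (allFin q) M n
    letters _ a<n with y , wa≡y ← <⇒‼-just w a<n = y , wa≡y , ∈-allFin y

  -- For i < M: t is the least position closing a distant pair opened at or after i, and r the last opening.
  record Closing (i : ℕ) : Set where
    field
      r t       : ℕ
      c         : Fin q
      i≤r       : i ≤ r
      2+r≤t     : 2 + r ≤ t
      w[r]      : w ‼ r ≡ just c
      w[t]      : w ‼ t ≡ just c
      distinct  : RunDistinct i t
      noInnerC  : ∀ {a} → r < a → 2 + a ≤ t → w ‼ a ≢ just c

  closing : ∀ {i} → HasDistantPair i → Closing i
  closing {i} pair with least (Closes? i) (proj₂ (proj₂ pair))
  ... | t , (t<n , a , a<t , pairAt) , noEarlier with greatestBelow (DistantPair? i t) a<t pairAt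
  ...   | r , r<t , (i≤r , 2+r≤t , wr≡wt) , noLater with <⇒‼-just w t<n
  ...     | c , wt≡c = record
    { r = r ; t = t ; c = c ; i≤r = i≤r ; 2+r≤t = 2+r≤t ; w[r] = trans wr≡wt wt≡c ; w[t] = wt≡c
    ; distinct = noDistantRepeat⇒RunDistinct λ {a} {b} i≤a 2+a≤b b<t wa≡wb →
        noEarlier b<t (<-trans b<t t<n , a , <-trans (n<1+n a) 2+a≤b , i≤a , 2+a≤b , wa≡wb)
    ; noInnerC = λ r<a 2+a≤t wa≡c →
        noLater r<a (<-trans (n<1+n _) 2+a≤t) (≤-trans i≤r (<⇒≤ r<a) , 2+a≤t , trans wa≡c (sym wt≡c))
    }

  module Analysis {i} (cl : Closing i) where
    open Closing cl

    Ac = remove c (allFin q)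
    X  = segment (suc r) t

    r<t : r < t
    r<t = <-trans (n<1+n r) 2+r≤t

    t<n : t < n
    t<n = ‼-just⇒< w t w[t]

    t≡1+r+|X| : t ≡ suc r + length X
    t≡1+r+|X| = sym (trans (cong (suc r +_) (length-segment r<t (<⇒≤ t<n))) (m+[n∸m]≡n r<t))

    occurs : OccursAt w r (bracket c X)
    occurs = segment-bracket-OccursAt w Fin._≟_ w[r] w[t] r<t

    1+pred[t]≡t : suc (pred t) ≡ t
    1+pred[t]≡t = suc-pred t {{>-nonZero (≤-trans (s≤s z≤n) r<t)}}

    -- the closing letter is tripled: w[r, t] = ccc
    module Tripled (w[t-1] : w ‼ pred t ≡ just c) where

      pred[t]≡1+r : pred t ≡ suc r
      pred[t]≡1+r = distinct i≤r (≤-pred (subst (2 + r ≤_) (sym 1+pred[t]≡t) 2+r≤t)) (subst (pred t <_) 1+pred[t]≡t ≤-refl)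
                      (trans w[r] (sym w[t-1]))

      occurs₃ : OccursAt w r (bracket c [ c ])
      occurs₃ {zero}               _ = trans (cong (w ‼_) (+-identityʳ r)) w[r]
      occurs₃ {suc zero}           _ = trans (cong (w ‼_) (trans (+-comm r 1) (sym pred[t]≡1+r))) w[t-1]
      occurs₃ {suc (suc zero)}     _ = trans (cong (w ‼_) (trans (+-comm r 2) (trans (cong suc (sym pred[t]≡1+r)) 1+pred[t]≡t))) w[t]
      occurs₃ {suc (suc (suc _))} (s≤s (s≤s (s≤s ())))

      w[1+r] : w ‼ suc r ≡ just c
      w[1+r] = subst (λ k → w ‼ k ≡ just c) pred[t]≡1+r w[t-1]

      1+r<t : suc r < t
      1+r<t = subst (_< t) pred[t]≡1+r (subst (pred t <_) 1+pred[t]≡t ≤-refl)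

      offset< : r ∸ i < 2 * q
      offset< = ≤-<-trans (m≤n+o⇒m∸n≤o r i (subst (r ≤_) (+-comm _ i) bound)) (*-monoʳ-< 2 (length-remove-allFin c))
        where
        letters : UsesOnly Ac i r
        letters {a} i≤a a<r with y , wa≡y ← <⇒‼-just w (<-trans a<r (<-trans r<t t<n)) =
          y , wa≡y , ∈-remove (∈-allFin y) λ { refl →
            <⇒≢ a<r (sym (suc-injective (distinct i≤a (<-trans a<r (n<1+n r)) 1+r<t (trans wa≡y (sym w[1+r]))))) }
        bound : r ≤ 2 * length Ac + i
        bound = runDistinct-length (RunDistinct-mono distinct ≤-refl (<⇒≤ r<t)) letters

    -- otherwise c does not occur in X = w(r, t)
    module Plain (¬w[t-1] : w ‼ pred t ≢ just c) where

      avoidsC : Avoids c (suc r) t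
      avoidsC {a} r<a a<t wa≡c with suc a ≟ t
      ... | yes 1+a≡t = ¬w[t-1] (subst (λ k → w ‼ pred k ≡ just c) 1+a≡t wa≡c)
      ... | no  1+a≢t = noInnerC r<a (≤∧≢⇒< a<t 1+a≢t) wa≡c

      c∉X : c ∉ X
      c∉X = Avoids⇒∉segment avoidsC

      X≢[] : X ≢ []
      X≢[] X≡[] = <-irrefl refl (subst (2 + r ≤_) t≡1+r 2+r≤t)
        where
        t≡1+r : t ≡ suc r
        t≡1+r = trans t≡1+r+|X| (trans (cong (λ Y → suc r + length Y) X≡[]) (+-identityʳ (suc r)))

      letters : UsesOnly Ac (suc r) t
      letters r<a a<t with y , wa≡y ← <⇒‼-just w (<-trans a<t t<n) =
        y , wa≡y , ∈-remove (∈-allFin y) λ { refl → avoidsC r<a a<t wa≡y }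

      runWord : Realises (runWords⁺ q Ac) Ac (suc r) t
      runWord = segment∈runWords⁺ q (<⇒≤ (length-remove-allFin c))
                  (RunDistinct-mono distinct (≤-trans i≤r (n≤1+n r)) ≤-refl) letters 2+r≤t

      B = proj₁ runWord

      -- The letters of w[i, r − 1) are neither c nor letters of X, so they are among the unused letters B.
      offset<first : r ∸ i < 2 * length B + 2
      offset<first = subst (r ∸ i <_) (+-comm 2 (2 * length B)) (s≤s (m≤n+o⇒m∸n≤o r i (begin
        r                       ≤⟨ n≤1+pred[n] r ⟩
        suc (pred r)            ≤⟨ s≤s bound ⟩
        suc (2 * length B + i)  ≡⟨ regroup (length B) i ⟩
        i + suc (2 * length B)  ∎)))
        where
        open ≤-Reasoning
        letters′ : UsesOnly B i (pred r)
        letters′ {a} i≤a a<r′ with y , wa≡y ← <⇒‼-just w (<-trans (<-≤-trans a<r′ pred[n]≤n) (<-trans r<t t<n)) =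
          y , wa≡y , proj₂ (proj₂ runWord) (∈-remove (∈-allFin y) notC) notInX
          where
          a<r : a < r
          a<r = <-≤-trans a<r′ pred[n]≤n
          notC : y ≢ c
          notC refl = <⇒≢ a<r′ (sym (cong pred (distinct i≤a a<r r<t (trans wa≡y (sym w[r])))))
          notInX : Avoids y (suc r) t
          notInX r<b b<t wb≡y = <⇒≱ r<b (subst (_≤ r) (sym (distinct i≤a (<-trans a<r r<b) b<t (trans wa≡y (sym wb≡y)))) a<r)
        bound : pred r ≤ 2 * length B + i
        bound = runDistinct-length (RunDistinct-mono distinct ≤-refl (≤-trans pred[n]≤n (<⇒≤ r<t))) letters′
        regroup : ∀ b i → suc (2 * b + i) ≡ i + suc (2 * b)
        regroup = solve-∀

      -- The last letters of X in the occurrences of cXc at p and r form a distant pair inside w[i, t).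
      offset<repeat : ∀ {p} → p < r → OccursAt w p (bracket c X) → r ∸ i < 2
      offset<repeat {p} p<r occ with 2 + i ≤? r
      ... | no  r<2+i = m<n+o⇒m∸n<o r i (subst (r <_) (+-comm 2 i) (≰⇒> r<2+i))
      ... | yes 2+i≤r = contradiction (distinct i≤a a<b b<t (trans (occ |X|<) (sym (occurs |X|<)))) (<⇒≢ 1+a<b ∘ sym)
        where
        |X| = length X
        |X|< : |X| < length (bracket c X)
        |X|< = subst (|X| <_) (sym (length-bracket c X)) (≤-trans (n<1+n |X|) (n≤1+n _))
        i≤a : i ≤ p + |X|
        i≤a = ≤-pred (≤-pred (≤-trans 2+i≤r (≤-trans (occurrences-close free occ occurs X≢[]) (≤-reflexive (regroup p |X|)))))
          where
          regroup : ∀ p l → p + (2 + l) ≡ 2 + (p + l)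
          regroup = solve-∀
        a<b : p + |X| < r + |X|
        a<b = +-monoˡ-< |X| p<r
        b<t : r + |X| < t
        b<t = subst (r + |X| <_) (sym t≡1+r+|X|) ≤-refl
        1+a<b : suc (p + |X|) < r + |X|
        1+a<b = begin-strict
          suc (p + |X|) ≡⟨ +-suc p |X| ⟨
          p + suc |X|   ≤⟨ occurrences-apart w occ occurs c∉X p<r ⟩
          r             <⟨ m<m+n r (≢[]⇒0<length X≢[]) ⟩
          r + |X|       ∎
          where open ≤-Reasoning

  firstTriple : ∀ {p c} → OccursAt w p (bracket c [ c ]) → ∃ (Least (λ p → OccursAt w p (bracket c [ c ])))
  firstTriple = least (λ p → OccursAt? Fin._≟_ w p _)

  module _ {i} (cl : Closing i) where
    open Closing cl
    open Analysis cl

    Earlier : Set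
    Earlier = ∃[ p ] p < r × OccursAt w p (bracket c X)

    codeFor : Dec (w ‼ pred t ≡ just c) → Dec Earlier → Code q
    codeFor (yes w[t-1]) _ = tripled c (r ∸ i) (r ∸ proj₁ (firstTriple (Tripled.occurs₃ w[t-1])))
    codeFor (no  _)      e = plain c X (r ∸ i) (isYes e)

    code : Code q
    code = codeFor (Maybe.≡-dec Fin._≟_ (w ‼ pred t) (just c)) (anyUpTo? (λ p → OccursAt? Fin._≟_ w p (bracket c X)) r)

    codeFor∈codes : ∀ tr e → codeFor tr e ∈ codes q
    codeFor∈codes (yes w[t-1]) _ =
      ∈-concatMap⁺′ (codesFor q) (∈-allFin c)
        (∈-++⁺ʳ _ (∈-concatMap⁺′ _ (∈-upTo⁺ offset<) (∈-map⁺ (tripled c _) (∈-upTo⁺ d<4))))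
      where
      open Tripled w[t-1]
      p₀ = proj₁ (firstTriple occurs₃)
      d<4 : r ∸ p₀ < 4
      d<4 = s≤s (m≤n+o⇒m∸n≤o r p₀ (occurrences-close free {X = [ c ]} (proj₁ (proj₂ (firstTriple occurs₃))) occurs₃ (λ ())))
    codeFor∈codes (no ¬w[t-1]) e =
      ∈-concatMap⁺′ (codesFor q) (∈-allFin c) (∈-++⁺ˡ (∈-concatMap⁺′ (plainCodes c) X∈ (bit e)))
      where
      open Plain ¬w[t-1]
      X∈ = proj₁ (proj₂ runWord)
      bit : ∀ e → plain c X (r ∸ i) (isYes e) ∈ plainCodes c (X , B)
      bit (yes (p , p<r , occ)) = ∈-++⁺ʳ _ (∈-map⁺ (λ o → plain c X o true) (∈-upTo⁺ (offset<repeat p<r occ)))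
      bit (no _)                = ∈-++⁺ˡ (∈-map⁺ (λ o → plain c X o false) (∈-upTo⁺ offset<first))

    code∈codes : code ∈ codes q
    code∈codes = codeFor∈codes _ _

  private
    tripled-injective : ∀ {c c′ o o′ d d′} → tripled {q} c o d ≡ tripled c′ o′ d′ → c ≡ c′ × o ≡ o′ × d ≡ d′
    tripled-injective refl = refl , refl , refl

    plain-injective : ∀ {c c′ X X′ o o′ b b′} → plain {q} c X o b ≡ plain c′ X′ o′ b′ →
                      c ≡ c′ × X ≡ X′ × o ≡ o′ × b ≡ b′
    plain-injective refl = refl , refl , refl , refl

    OccursAt-subst : ∀ {p c c′ X X′} → OccursAt w p (bracket c X) → c ≡ c′ → X ≡ X′ → OccursAt w p (bracket c′ X′)
    OccursAt-subst occ refl refl = occ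

  same-offset : ∀ {i j r r′} → i ≤ r → j ≤ r′ → r ≡ r′ → r ∸ i ≡ r′ ∸ j → i ≡ j
  same-offset i≤r j≤r′ refl = ∸-cancelˡ-≡ i≤r j≤r′

  module _ {i j} (ci : Closing i) (cj : Closing j) where
    private
      module Cᵢ = Closing ci
      module Cⱼ = Closing cj
      module Aᵢ = Analysis ci
      module Aⱼ = Analysis cj

    plain-ordered : ∀ (¬tⱼ : w ‼ pred Cⱼ.t ≢ just Cⱼ.c) (ei : Dec (Earlier ci)) (ej : Dec (Earlier cj)) →
                    Cᵢ.c ≡ Cⱼ.c → Aᵢ.X ≡ Aⱼ.X → isYes ei ≡ isYes ej → ¬ (Cᵢ.r < Cⱼ.r)
    plain-ordered ¬tⱼ ei (no noEarlier) c≡ X≡ _ rᵢ<rⱼ = noEarlier (Cᵢ.r , rᵢ<rⱼ , OccursAt-subst Aᵢ.occurs c≡ X≡)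
    plain-ordered ¬tⱼ (no _) (yes _) _ _ () _
    plain-ordered ¬tⱼ (yes (p , p<rᵢ , occ)) (yes _) c≡ X≡ _ rᵢ<rⱼ =
      no-three-occurrences free (OccursAt-subst occ c≡ X≡) (OccursAt-subst Aᵢ.occurs c≡ X≡) Aⱼ.occurs
        (Aⱼ.Plain.c∉X ¬tⱼ) (Aⱼ.Plain.X≢[] ¬tⱼ) p<rᵢ rᵢ<rⱼ

  codeFor-injective : ∀ {i j} (ci : Closing i) (cj : Closing j) tᵢ eᵢ tⱼ eⱼ →
                      codeFor ci tᵢ eᵢ ≡ codeFor cj tⱼ eⱼ → i ≡ j
  codeFor-injective ci cj (yes tᵢ) _ (yes tⱼ) _ eq with tripled-injective eq
  ... | c≡ , o≡ , d≡ = same-offset (Closing.i≤r ci) (Closing.i≤r cj) r≡ o≡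
    where
    module Tᵢ = Analysis.Tripled ci tᵢ
    module Tⱼ = Analysis.Tripled cj tⱼ
    firstᵢ = firstTriple Tᵢ.occurs₃
    firstⱼ = firstTriple Tⱼ.occurs₃
    p₀≡ : proj₁ firstᵢ ≡ proj₁ firstⱼ
    p₀≡ = Least-unique (subst (λ c → Least (λ p → OccursAt w p (bracket c [ c ])) (proj₁ firstᵢ)) c≡ (proj₂ firstᵢ))
                       (proj₂ firstⱼ)
    r≡ : Closing.r ci ≡ Closing.r cj
    r≡ = begin
      Closing.r ci                                  ≡⟨ m+[n∸m]≡n (Least-≤ (proj₂ firstᵢ) Tᵢ.occurs₃) ⟨
      proj₁ firstᵢ + (Closing.r ci ∸ proj₁ firstᵢ)  ≡⟨ cong₂ _+_ p₀≡ d≡ ⟩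
      proj₁ firstⱼ + (Closing.r cj ∸ proj₁ firstⱼ)  ≡⟨ m+[n∸m]≡n (Least-≤ (proj₂ firstⱼ) Tⱼ.occurs₃) ⟩
      Closing.r cj                                  ∎
      where open ≡-Reasoning
  codeFor-injective ci cj (yes _) _ (no _) _ ()
  codeFor-injective ci cj (no _)  _ (yes _) _ ()
  codeFor-injective ci cj (no tᵢ) eᵢ (no tⱼ) eⱼ eq with plain-injective eq | <-cmp (Closing.r ci) (Closing.r cj)
  ... | c≡ , X≡ , o≡ , b≡ | tri< rᵢ<rⱼ _ _ = contradiction rᵢ<rⱼ (plain-ordered ci cj tⱼ eᵢ eⱼ c≡ X≡ b≡)
  ... | _  , _  , o≡ , _  | tri≈ _ r≡ _    = same-offset (Closing.i≤r ci) (Closing.i≤r cj) r≡ o≡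
  ... | c≡ , X≡ , _  , b≡ | tri> _ _ rⱼ<rᵢ =
    contradiction rⱼ<rᵢ (plain-ordered cj ci tᵢ eⱼ eᵢ (sym c≡) (sym X≡) (sym b≡))

  code-injective : ∀ {i j} (ci : Closing i) (cj : Closing j) → code ci ≡ code cj → i ≡ j
  code-injective ci cj = codeFor-injective ci cj _ _ _ _

  M≤length-codes : M ≤ length (codes q)
  M≤length-codes = injective⇒≤ {f = index} index-injective
    where
    closingAt : (k : Fin M) → Closing (toℕ k)
    closingAt k = closing (<M⇒HasDistantPair (toℕ<n k))
    index : Fin M → Fin (length (codes q))
    index k = Any.index (code∈codes (closingAt k))
    index-injective : ∀ {k l} → index k ≡ index l → k ≡ l
    index-injective {k} {l} eq = toℕ-injective (code-injective (closingAt k) (closingAt l) (begin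
      code (closingAt k)                  ≡⟨ lookup-index (code∈codes (closingAt k)) ⟩
      lookup (codes q) (index k)          ≡⟨ cong (lookup (codes q)) eq ⟩
      lookup (codes q) (index l)          ≡⟨ lookup-index (code∈codes (closingAt l)) ⟨
      code (closingAt l)                  ∎))
      where open ≡-Reasoning

  length≤2q+codes : length w ≤ 2 * q + length (codes q)
  length≤2q+codes = ≤-trans length≤2q+M (+-monoʳ-≤ (2 * q) M≤length-codes)

-- Counting the codes

sum-map-++ : ∀ {A : Set} (f : A → ℕ) xs ys → sum (map f (xs ++ ys)) ≡ sum (map f xs) + sum (map f ys)
sum-map-++ f xs ys = trans (cong sum (map-++ f xs ys)) (sum-++ (map f xs) (map f ys))

sum-map-map : ∀ {A B : Set} (f : B → ℕ) (g : A → B) xs → sum (map f (map g xs)) ≡ sum (map (f ∘ g) xs)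
sum-map-map f g []       = refl
sum-map-map f g (x ∷ xs) = cong (f (g x) +_) (sum-map-map f g xs)

sum-map-concatMap : ∀ {A B : Set} (f : B → ℕ) (g : A → List B) xs →
                    sum (map f (concatMap g xs)) ≡ sum (map (sum ∘ map f ∘ g) xs)
sum-map-concatMap f g []       = refl
sum-map-concatMap f g (x ∷ xs) = trans (sum-map-++ f (g x) (concatMap g xs)) (cong (sum (map f (g x)) +_) (sum-map-concatMap f g xs))

length-concatMap : ∀ {A B : Set} (g : A → List B) xs → length (concatMap g xs) ≡ sum (map (length ∘ g) xs)
length-concatMap g []       = refl
length-concatMap g (x ∷ xs) = trans (length-++ (g x)) (cong (length (g x) +_) (length-concatMap g xs))

sum-map-≤ : ∀ {A : Set} (f : A → ℕ) {b} xs → (∀ {x} → x ∈ xs → f x ≤ b) → sum (map f xs) ≤ length xs * b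
sum-map-≤ f []       _     = z≤n
sum-map-≤ f (x ∷ xs) bound = +-mono-≤ (bound (here refl)) (sum-map-≤ f xs (bound ∘ there))

-- K follows the recursion of runWords: the empty word, then two run lengths for each first letter.
K : ℕ → ℕ
K zero    = 4
K (suc m) = 2 * suc m + 4 + suc m * (2 * K m)

K-mono : ∀ {m n} → m ≤ n → K m ≤ K n
K-mono m≤n = mono′ (≤⇒≤′ m≤n)
  where
  step : ∀ m → K m ≤ K (suc m)
  step m = ≤-trans (m≤n*m (K m) 2) (≤-trans (m≤n*m (2 * K m) (suc m)) (m≤n+m _ (2 * suc m + 4)))
  mono′ : ∀ {m n} → m ≤′ n → K m ≤ K n
  mono′ ≤′-refl        = ≤-refl
  mono′ {n = suc n} (≤′-step m≤′n) = ≤-trans (mono′ m≤′n) (step n)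

module _ {A : Set} (_≟_ : DecidableEquality A) where
  open RunWords _≟_

  weight : List A × List A → ℕ
  weight (X , B) = 2 * length B + 4

  runWords-weight  : ∀ f B → sum (map weight (runWords f B)) ≤ K (length B)
  runWords⁺-weight : ∀ f B → sum (map weight (runWords⁺ f B)) ≤ length B * (2 * K (pred (length B)))

  runWords-weight f []      = +-monoʳ-≤ 4 (runWords⁺-weight f [])
  runWords-weight f (a ∷ B) = +-monoʳ-≤ (weight ([] , a ∷ B)) (runWords⁺-weight f (a ∷ B))

  runWords⁺-weight zero    B = z≤n
  runWords⁺-weight (suc f) B = begin
    sum (map weight (runWords⁺ (suc f) B))           ≡⟨ sum-map-concatMap weight extensions B ⟩
    sum (map (sum ∘ map weight ∘ extensions) B)          ≤⟨ sum-map-≤ (sum ∘ map weight ∘ extensions) B perLetter ⟩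
    length B * (2 * K (pred (length B)))                 ∎
    where
    open ≤-Reasoning
    extensions : A → List (List A × List A)
    extensions a = map (extend [ a ]) (runWords f (remove a B))
                ++ map (extend (a ∷ a ∷ [])) (runWords f (remove a B))
    perLetter : ∀ {a} → a ∈ B → sum (map weight (extensions a)) ≤ 2 * K (pred (length B))
    perLetter {a} a∈B = begin
      sum (map weight (extensions a))                                   ≡⟨ sum-map-++ weight (map (extend [ a ]) R) _ ⟩
      sum (map weight (map (extend [ a ]) R))
        + sum (map weight (map (extend (a ∷ a ∷ [])) R))            ≡⟨ cong₂ _+_ (sum-map-map weight (extend [ a ]) R)
                                                                                     (sum-map-map weight (extend (a ∷ a ∷ [])) R) ⟩
      sum (map weight R) + sum (map weight R)                           ≡⟨ cong (sum (map weight R) +_) (+-identityʳ _) ⟨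
      2 * sum (map weight R)                                            ≤⟨ *-monoʳ-≤ 2 (runWords-weight f (remove a B)) ⟩
      2 * K (length (remove a B))                                   ≤⟨ *-monoʳ-≤ 2 (K-mono (<⇒≤pred (length-remove-∈ a∈B))) ⟩
      2 * K (pred (length B))                                           ∎
      where R = runWords f (remove a B)

length-plainCodes : ∀ {q} (c : Fin q) e → length (plainCodes c e) ≡ weight Fin._≟_ e
length-plainCodes c (X , B) = begin
  length (plainCodes c (X , B))  ≡⟨ length-++ (map (λ o → plain c X o false) (upTo (2 * length B + 2))) ⟩
  length unmarked + length marked
                                 ≡⟨ cong₂ _+_ (trans (length-map (λ o → plain c X o false) (upTo (2 * length B + 2))) (length-upTo (2 * length B + 2)))
                                              (trans (length-map (λ o → plain c X o true) (upTo 2)) (length-upTo 2)) ⟩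
  2 * length B + 2 + 2           ≡⟨ +-assoc (2 * length B) 2 2 ⟩
  2 * length B + 4               ∎
  where
  open ≡-Reasoning
  unmarked = map (λ o → plain c X o false) (upTo (2 * length B + 2))
  marked   = map (λ o → plain c X o true) (upTo 2)

length-tripledCodes : ∀ q (c : Fin q) → length (tripledCodes q c) ≤ 2 * q * 4
length-tripledCodes q c = begin
  length (tripledCodes q c)                                      ≡⟨ length-concatMap (λ o → map (tripled c o) (upTo 4)) (upTo (2 * q)) ⟩
  sum (map (λ o → length (map (tripled c o) (upTo 4))) (upTo (2 * q)))
                                                                 ≤⟨ sum-map-≤ _ (upTo (2 * q)) (λ {o} _ → ≤-reflexive (length-map (tripled c o) (upTo 4))) ⟩
  length (upTo (2 * q)) * 4                                      ≡⟨ cong (_* 4) (length-upTo (2 * q)) ⟩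
  2 * q * 4                                                      ∎
  where open ≤-Reasoning

codesBound : ℕ → ℕ
codesBound q = q * (pred q * (2 * K (pred (pred q))) + 2 * q * 4)

length-codes : ∀ q → length (codes q) ≤ codesBound q
length-codes q = begin
  length (codes q)                                  ≡⟨ length-concatMap (codesFor q) (allFin q) ⟩
  sum (map (length ∘ codesFor q) (allFin q))        ≤⟨ sum-map-≤ (length ∘ codesFor q) (allFin q) (λ {c} _ → length-codesFor c) ⟩
  length (allFin q) * perLetter                     ≡⟨ cong (_* perLetter) (length-allFin q) ⟩
  q * perLetter                                     ∎
  where
  open ≤-Reasoning
  perLetter = pred q * (2 * K (pred (pred q))) + 2 * q * 4
  length-codesFor : ∀ c → length (codesFor q c) ≤ perLetter
  length-codesFor c = begin
    length (codesFor q c)                                         ≡⟨ length-++ (concatMap (plainCodes c) RW) ⟩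
    length (concatMap (plainCodes c) RW) + length (tripledCodes q c)
                                                                  ≤⟨ +-monoʳ-≤ _ (length-tripledCodes q c) ⟩
    length (concatMap (plainCodes c) RW) + 2 * q * 4              ≡⟨ cong (_+ 2 * q * 4) (length-concatMap (plainCodes c) RW) ⟩
    sum (map (length ∘ plainCodes c) RW) + 2 * q * 4              ≡⟨ cong (λ l → sum l + 2 * q * 4) (map-cong (length-plainCodes c) RW) ⟩
    sum (map (weight Fin._≟_) RW) + 2 * q * 4                     ≤⟨ +-monoˡ-≤ _ (runWords⁺-weight Fin._≟_ q Ac) ⟩
    length Ac * (2 * K (pred (length Ac))) + 2 * q * 4            ≤⟨ +-monoˡ-≤ _ (*-mono-≤ |Ac|≤ (*-monoʳ-≤ 2 (K-mono (pred-mono-≤ |Ac|≤)))) ⟩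
    perLetter                                                     ∎
    where
    Ac = RunWords.remove Fin._≟_ c (allFin q)
    RW = RunWords.runWords⁺ Fin._≟_ q Ac
    |Ac|≤ : length Ac ≤ pred q
    |Ac|≤ = <⇒≤pred (length-remove-allFin c)

-- Numerical bounds

K+4≤9·2^n·n! : ∀ m → K (suc m) + 4 ≤ 9 * (2 ^ suc m * suc m !)
K+4≤9·2^n·n! zero    = ≤-refl
K+4≤9·2^n·n! (suc m) = begin
  K s + 4                              ≡⟨ regroup s (K (suc m)) ⟩
  (2 * s + 8) + s * (2 * K (suc m))    ≤⟨ +-monoˡ-≤ _ linear ⟩
  8 * s + s * (2 * K (suc m))          ≡⟨ factor s (K (suc m)) ⟩
  s * (2 * (K (suc m) + 4))            ≤⟨ *-monoʳ-≤ s (*-monoʳ-≤ 2 (K+4≤9·2^n·n! m)) ⟩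
  s * (2 * (9 * (2 ^ suc m * suc m !)))  ≡⟨ unfold s (2 ^ suc m) (suc m !) ⟩
  9 * (2 ^ s * s !)                    ∎
  where
  open ≤-Reasoning
  s = suc (suc m)
  regroup : ∀ s k → 2 * s + 4 + s * (2 * k) + 4 ≡ 2 * s + 8 + s * (2 * k)
  regroup = solve-∀
  factor : ∀ s k → 8 * s + s * (2 * k) ≡ s * (2 * (k + 4))
  factor = solve-∀
  unfold : ∀ s P F → s * (2 * (9 * (P * F))) ≡ 9 * ((2 * P) * (s * F))
  unfold = solve-∀
  linear : 2 * s + 8 ≤ 8 * s
  linear = subst (2 * s + 8 ≤_) (sym (split m)) (m≤m+n _ _)
    where
    split : ∀ m → 8 * suc (suc m) ≡ 2 * suc (suc m) + 8 + (6 * m + 4)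
    split = solve-∀

wordBound : ℕ → ℕ
wordBound q = suc (2 * q + codesBound q)

1≤2^n : ∀ n → 1 ≤ 2 ^ n
1≤2^n n = m^n>0 2 n

10·wordBound≤49·2^q·q! : ∀ m → 10 * wordBound (4 + m) ≤ 49 * (2 ^ (4 + m) * (4 + m) !)
10·wordBound≤49·2^q·q! m = begin
  10 * wordBound q                                                        ≤⟨ *-monoʳ-≤ 10 (s≤s (+-monoʳ-≤ (2 * q)
                                                                               (*-monoʳ-≤ q (+-monoˡ-≤ _ (*-monoʳ-≤ (3 + m) (*-monoʳ-≤ 2 K≤)))))) ⟩
  10 * suc (2 * q + q * ((3 + m) * (2 * (9 * (P * F))) + 2 * q * 4))     ≡⟨ expand m P F ⟩
  180 * Z + 10 * (1 + 2 * q + 8 * (q * q))                                ≤⟨ +-monoʳ-≤ (180 * Z) quadratic ⟩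
  180 * Z + 16 * Z                                                        ≡⟨ collect m P F ⟩
  49 * (2 ^ q * q !)                                                      ∎
  where
  open ≤-Reasoning
  q = 4 + m
  P = 2 ^ (2 + m)
  F = (2 + m) !
  Z = q * (3 + m) * (P * F)
  K≤ : K (2 + m) ≤ 9 * (P * F)
  K≤ = ≤-trans (m≤m+n _ 4) (K+4≤9·2^n·n! (suc m))
  expand : ∀ m P F → 10 * suc (2 * (4 + m) + (4 + m) * ((3 + m) * (2 * (9 * (P * F))) + 2 * (4 + m) * 4))
                     ≡ 180 * ((4 + m) * (3 + m) * (P * F)) + 10 * (1 + 2 * (4 + m) + 8 * ((4 + m) * (4 + m)))
  expand = solve-∀
  collect : ∀ m P F → 180 * ((4 + m) * (3 + m) * (P * F)) + 16 * ((4 + m) * (3 + m) * (P * F))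
                      ≡ 49 * ((2 * (2 * P)) * ((4 + m) * ((3 + m) * F)))
  collect = solve-∀
  8≤P·F : 8 ≤ P * F
  8≤P·F = begin
    8                                           ≤⟨ m≤m+n 8 _ ⟩
    8 + (12 * m + 4 * (m * m))                  ≡⟨ atLeast8 m ⟩
    4 * (2 + m) * (1 + m) * 1                   ≤⟨ *-monoʳ-≤ (4 * (2 + m) * (1 + m)) (*-mono-≤ (1≤2^n m) (1≤n! m)) ⟩
    4 * (2 + m) * (1 + m) * (2 ^ m * m !)       ≡⟨ unfold m (2 ^ m) (m !) ⟩
    P * F                                       ∎
    where
    atLeast8 : ∀ m → 8 + (12 * m + 4 * (m * m)) ≡ 4 * (2 + m) * (1 + m) * 1
    atLeast8 = solve-∀
    unfold : ∀ m P′ F′ → 4 * (2 + m) * (1 + m) * (P′ * F′) ≡ (2 * (2 * P′)) * ((2 + m) * ((1 + m) * F′))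
    unfold = solve-∀
  quadratic : 10 * (1 + 2 * q + 8 * (q * q)) ≤ 16 * Z
  quadratic = begin
    10 * (1 + 2 * q + 8 * (q * q))                              ≤⟨ m≤m+n _ (48 * (m * m) + 236 * m + 166) ⟩
    10 * (1 + 2 * q + 8 * (q * q)) + (48 * (m * m) + 236 * m + 166) ≡⟨ complete m ⟩
    16 * (q * (3 + m) * 8)                                      ≤⟨ *-monoʳ-≤ 16 (*-monoʳ-≤ (q * (3 + m)) 8≤P·F) ⟩
    16 * Z                                                      ∎
    where
    complete : ∀ m → 10 * (1 + 2 * (4 + m) + 8 * ((4 + m) * (4 + m))) + (48 * (m * m) + 236 * m + 166)
                     ≡ 16 * ((4 + m) * (3 + m) * 8)
    complete = solve-∀

-- 24 · 49² = 57624 < 58500 = 100 · 65 · 9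
square-bound : ∀ n X → 10 * n ≤ 49 * X → 1 ≤ X → n * n * 24 < 65 * (9 * (X * X))
square-bound n X 10n≤49X 1≤X = *-cancelˡ-< 100 _ _ (begin-strict
  100 * (n * n * 24)                   ≡⟨ lhs n ⟩
  24 * (10 * n * (10 * n))             ≤⟨ *-monoʳ-≤ 24 (*-mono-≤ 10n≤49X 10n≤49X) ⟩
  24 * (49 * X * (49 * X))             ≡⟨ middle X ⟩
  57624 * (X * X)                      <⟨ m<m+n _ (*-mono-≤ (s≤s (z≤n {875})) (*-mono-≤ 1≤X 1≤X)) ⟩
  57624 * (X * X) + 876 * (X * X)      ≡⟨ rhs X ⟩
  100 * (65 * (9 * (X * X)))           ∎)
  where
  open ≤-Reasoning
  lhs : ∀ n → 100 * (n * n * 24) ≡ 24 * (10 * n * (10 * n))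
  lhs = solve-∀
  middle : ∀ X → 24 * (49 * X * (49 * X)) ≡ 57624 * (X * X)
  middle = solve-∀
  rhs : ∀ X → 57624 * (X * X) + 876 * (X * X) ≡ 100 * (65 * (9 * (X * X)))
  rhs = solve-∀

-- ePartial 4 = 65/24
/-<-ePartial4 : ∀ a D .{{_ : NonZero D}} → a * 24 < 65 * D → (ℤ.+ a / D) ℚ.< ePartial 4
/-<-ePartial4 a (suc d) lt = toℚᵘ-cancel-< (<-respˡ-≃ (≃-sym (toℚᵘ-fromℚᵘ (ℚᵘ.mkℚᵘ (ℤ.+ a) d)))
  (ℚᵘ.*<* (subst₂ ℤ._<_ (ℤ.pos-* a 24) (ℤ.pos-* 65 (suc d)) (+<+ lt))))

∀-words? : ∀ {q} {P : List (Fin q) → Set} → Decidable P → ∀ m → Dec (∀ w → length w ≡ m → P w)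
∀-words? P? zero    = map′ (λ P[] → λ { [] refl → P[] }) (λ all → all [] refl) (P? [])
∀-words? P? (suc m) = map′ (λ all → λ { (a ∷ w) |w|≡m → all a w (suc-injective |w|≡m) })
                           (λ all a w |w|≡m → all (a ∷ w) (cong suc |w|≡m))
                           (all? (λ a → ∀-words? (P? ∘ (a ∷_)) m))

4^n≡2^n·2^n : ∀ n → 4 ^ n ≡ 2 ^ n * 2 ^ n
4^n≡2^n·2^n zero    = refl
4^n≡2^n·2^n (suc n) = trans (cong (4 *_) (4^n≡2^n·2^n n)) (square (2 ^ n))
  where
  square : ∀ T → 4 * (T * T) ≡ (2 * T) * (2 * T)
  square = solve-∀

allWordsContainZ₃-wordBound : ∀ q → AllWordsContainZ₃ q (wordBound q)
allWordsContainZ₃-wordBound q w |w|≡ with Contains-Z₃? Fin._≟_ w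
... | yes contains = contains
... | no  free     = contradiction (subst (_≤ 2 * q + codesBound q) |w|≡
                      (≤-trans (Z₃Free.length≤2q+codes w free) (+-monoʳ-≤ (2 * q) (length-codes q)))) (<-irrefl refl)

f₃-bound : ∀ q → 10 * wordBound q ≤ 49 * (2 ^ q * q !) → ∃[ n ] (IsF3 q n × LtBound q n)
f₃-bound q numeric with least (∀-words? (Contains-Z₃? Fin._≟_)) (allWordsContainZ₃-wordBound q)
... | n , allN , below = n , (allN , λ _ → Least-≤ (allN , below)) , 4 ,
      /-<-ePartial4 (n * n) _ {{D≢0}} (subst (n * n * 24 <_) (cong (65 *_) (sym D≡)) (square-bound n X 10n≤49X 1≤X))
  where
  X = 2 ^ q * q !
  10n≤49X : 10 * n ≤ 49 * X
  10n≤49X = ≤-trans (*-monoʳ-≤ 10 (Least-≤ (allN , below) (allWordsContainZ₃-wordBound q))) numeric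
  1≤X : 1 ≤ X
  1≤X = *-mono-≤ (1≤2^n q) (1≤n! q)
  D≡ : 9 * 4 ^ q * (q ! * q !) ≡ 9 * (X * X)
  D≡ = trans (cong (λ T → 9 * T * (q ! * q !)) (4^n≡2^n·2^n q)) (regroup (2 ^ q) (q !))
    where
    regroup : ∀ T F → 9 * (T * T) * (F * F) ≡ 9 * (T * F * (T * F))
    regroup = solve-∀
  D≢0 : NonZero (9 * 4 ^ q * (q ! * q !))
  D≢0 = >-nonZero (subst (0 <_) (sym D≡) (*-mono-≤ (s≤s (z≤n {8})) (*-mono-≤ 1≤X 1≤X)))

theorem5p1 : (q : ℕ) → 3 < q → ∃[ n ] (IsF3 q n × LtBound q n)
theorem5p1 _ (s≤s (s≤s (s≤s (s≤s {n = m} z≤n)))) = f₃-bound _ (10·wordBound≤49·2^q·q! m)
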